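{- Let $\nu\in\mathcal{E}$ with expanded indexing and index sets $I,J$. The function $\mathbf{Br}_\nu:I\to I\cup J$ is non-decreasing on $I$, and for every $i\in I$ with $\mathbf{Br}_\nu(i)\in I$ we have $\mathbf{Br}_\nu(\mathbf{Br}_\nu(i))=\mathbf{Br}_\nu(i)$.
   Context: Primary colors $a_1<\cdots<a_n$; secondary colors $a_ia_j$ ($i<j$); total order $a_1a_2<\cdots<a_1a_n<a_1<a_2a_3<\cdots<a_2a_n<a_2<\cdots<a_{n-1}a_n<a_{n-1}<a_n$. A part $k_p$ has integer size $k$ and color $p$; $k_p+m=(k+m)_p$. $k_p\succ l_q$ iff $k-l\ge\chi(p\le q)$; $\succeq$ means $\succ$ or equal. Special pairs: $(a_ka_l,a_ia_j)$ with $i<j<k<l$ or $k<i<j<l$. $\mathcal{P}$: primary-colored parts of positive size; $\mathcal{S}$: secondary-colored parts of size $\ge2$. $k_p\gg l_q$ iff $k_p\succeq(l+1)_q$ when $p$ or $q$ primary; $k_p\succ(l+1)_q$ when both secondary and not special; $k_p\succ l_q$ when special. $\mathcal{E}$: finite sequences $\nu_1\gg\cdots\gg\nu_t$ of parts in $\mathcal{P}\sqcup\mathcal{S}$. Halves: $\alpha((2k)_{a_ia_j})=k_{a_j}$, $\beta((2k)_{a_ia_j})=k_{a_i}$, $\alpha((2k+1)_{a_ia_j})=(k+1)_{a_i}$, $\beta((2k+1)_{a_ia_j})=k_{a_j}$. Expanded indexing: for $\nu\in\mathcal{E}$ with $p$ primary and $s$ secondary parts, $\nu=(\nu_1,\ldots,\nu_{p+2s})$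 obtained by replacing each secondary part in place by its upper half $\alpha$ then its lower half $\beta$; $J$ = indices of primary parts, $I$ = indices of upper halves. Set $\nu_{p+2s+1}=0_{a_n}$. Bridge: for $i\in I$ let $j=\min((i,p+2s+1]\cap(J\cup\{p+2s+1\}))$. If $\nu_{i'+1}\not\succ\nu_j+\frac{j-i'}{2}-1$ for all $i'\in[i,j)\cap I$, set $\mathbf{Br}_\nu(i)=j$; otherwise let $\mathcal{S}_i=\{u\in(i,j)\cap I:\nu_{i'+1}\not\succ\nu_u+\frac{u-i'}{2}-1\ \forall i'\in[i,u)\cap I\}$ and set $\mathbf{Br}_\nu(i)=\max\mathcal{S}_i$ if nonempty, $\mathbf{Br}_\nu(i)=i$ otherwise. -}

module Defs where

open import Data.Nat using (ℕ; zero; suc; _+_; _∸_; _≤_; _<_; _≤ᵇ_; _<ᵇ_; _≡ᵇ_; ⌊_/2⌋; ⌈_/2⌉)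
open import Data.Nat.Properties using (_≤?_)
open import Data.Fin using (Fin; toℕ; fromℕ)
open import Data.Bool using (Bool; true; false; if_then_else_; not; _∧_; _∨_; T)
open import Data.List using (List; []; _∷_; length; map; upTo)
open import Data.List.Relation.Unary.All using (All)
open import Data.List.Relation.Unary.Linked using (Linked)
open import Data.Maybe using (Maybe; just; nothing)
open import Data.Product using (_×_; _,_; proj₁; proj₂)
open import Data.Sum using (_⊎_)
open import Relation.Nullary using (does)
open import Relation.Binary.PropositionalEquality using (_≡_)

-- Colors, for n primary colors a_1 < ... < a_n (a_k is represented by
-- an element of Fin n, i.e. a 0-based index).

data Color (n : ℕ) : Set where
  prim : Fin n → Color n
  sec  : (i j : Fin n) → toℕ i < toℕ j → Color n

-- The total order a_1a_2 < ... < a_1a_n < a_1 < a_2a_3 < ... < a_2 < ...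
-- is lexicographic on (first index, second index) where a primary a_i
-- counts as (i, ∞) (here ∞ = n, larger than any index).
key₁ key₂ : {n : ℕ} → Color n → ℕ
key₁ (prim i) = toℕ i
key₁ (sec i j _) = toℕ i
key₂ {n} (prim i) = n
key₂ (sec i j _) = toℕ j

_≤ᶜ_ : {n : ℕ} → Color n → Color n → Bool
p ≤ᶜ q = (key₁ p <ᵇ key₁ q) ∨ ((key₁ p ≡ᵇ key₁ q) ∧ (key₂ p ≤ᵇ key₂ q))

isPrimary : {n : ℕ} → Color n → Bool
isPrimary (prim _) = true
isPrimary (sec _ _ _) = false

Special : {n : ℕ} → Color n → Color n → Set
Special (sec k l _) (sec i j _) =
  (toℕ j < toℕ k × toℕ k < toℕ l) ⊎ (toℕ k < toℕ i × toℕ j < toℕ l)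
Special _ _ = Data.Empty.⊥
  where import Data.Empty

-- Parts: k_p = (k , p) with size k and color p.

Part : ℕ → Set
Part n = ℕ × Color n

size : {n : ℕ} → Part n → ℕ
size = proj₁

color : {n : ℕ} → Part n → Color n
color = proj₂

_+ᵖ_ : {n : ℕ} → Part n → ℕ → Part n
(k , p) +ᵖ m = (k + m , p)

χ : Bool → ℕ
χ b = if b then 1 else 0

_≻_ : {n : ℕ} → Part n → Part n → Set
(k , p) ≻ (l , q) = l + χ (p ≤ᶜ q) ≤ k

≻ᵇ : {n : ℕ} → Part n → Part n → Bool
≻ᵇ (k , p) (l , q) = does (l + χ (p ≤ᶜ q) ≤? k)

_⪰_ : {n : ℕ} → Part n → Part n → Set
x ⪰ y = x ≻ y ⊎ x ≡ y

_≫_ : {n : ℕ} → Part n → Part n → Set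
(k , p) ≫ (l , q) with isPrimary p ∨ isPrimary q
... | true  = (k , p) ⪰ (suc l , q)
... | false = (Special p q × ((k , p) ≻ (l , q)))
            ⊎ ((Special p q → Data.Empty.⊥) × ((k , p) ≻ (suc l , q)))
  where import Data.Empty

InPS : {n : ℕ} → Part n → Set
InPS (k , prim _) = 1 ≤ k
InPS (k , sec _ _ _) = 2 ≤ k

InE : {n : ℕ} → List (Part n) → Set
InE ν = All InPS ν × Linked _≫_ ν

isEven : ℕ → Bool
isEven zero = true
isEven (suc k) = not (isEven k)

αsec βsec : {n : ℕ} → ℕ → Fin n → Fin n → Part n
αsec s i j = (⌈ s /2⌉ , prim (if isEven s then j else i))
βsec s i j = (⌊ s /2⌋ , prim (if isEven s then i else j))

data Kind : Set where
  primK  : Kind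
  upperK : Kind
  lowerK : Kind

expand : {n : ℕ} → List (Part n) → List (Part n × Kind)
expand [] = []
expand ((k , prim a) ∷ ν) = ((k , prim a) , primK) ∷ expand ν
expand ((k , sec i j _) ∷ ν) =
  (αsec k i j , upperK) ∷ (βsec k i j , lowerK) ∷ expand ν

nth : {A : Set} → List A → ℕ → Maybe A
nth [] _ = nothing
nth (x ∷ xs) zero = just x
nth (x ∷ xs) (suc k) = nth xs k

-- 1-based access to the expanded sequence
entry : {n : ℕ} → List (Part n) → ℕ → Maybe (Part n × Kind)
entry ν zero = nothing
entry ν (suc k) = nth (expand ν) k

len : {n : ℕ} → List (Part n) → ℕ
len ν = length (expand ν)

sentinel : (m : ℕ) → Part (suc m)
sentinel m = (0 , prim (fromℕ m))

-- ν_k for 1 ≤ k ≤ p+2s, and ν_{p+2s+1} = 0_{a_n}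
at : {m : ℕ} → List (Part (suc m)) → ℕ → Part (suc m)
at {m} ν k with entry ν k
... | just (x , _) = x
... | nothing = sentinel m

isKind : Kind → Kind → Bool
isKind primK primK = true
isKind upperK upperK = true
isKind lowerK lowerK = true
isKind _ _ = false

kindIs : {n : ℕ} → Kind → List (Part n) → ℕ → Bool
kindIs κ ν k with entry ν k
... | just (_ , κ') = isKind κ κ'
... | nothing = false

inIᵇ inJᵇ : {n : ℕ} → List (Part n) → ℕ → Bool
inIᵇ = kindIs upperK
inJᵇ = kindIs primK

_∈I_ : {n : ℕ} → ℕ → List (Part n) → Set
i ∈I ν = T (inIᵇ ν i)

range : ℕ → ℕ → List ℕ
range a b = map (a +_) (upTo (b ∸ a))

allᵇ : (ℕ → Bool) → List ℕ → Bool
allᵇ p [] = true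
allᵇ p (x ∷ xs) = p x ∧ allᵇ p xs

firstSat : (ℕ → Bool) → List ℕ → ℕ → ℕ
firstSat p [] d = d
firstSat p (x ∷ xs) d = if p x then x else firstSat p xs d

lastSat : (ℕ → Bool) → List ℕ → ℕ → ℕ
lastSat p [] d = d
lastSat p (x ∷ xs) d = lastSat p xs (if p x then x else d)

nextJ : {n : ℕ} → List (Part n) → ℕ → ℕ
nextJ ν i = firstSat (λ k → inJᵇ ν k ∨ (k ≡ᵇ suc (len ν)))
                     (range (suc i) (suc (suc (len ν)))) (suc (len ν))

bridgeCond : {m : ℕ} → List (Part (suc m)) → ℕ → ℕ → Bool
bridgeCond ν i u =
  allᵇ (λ i' → not (inIᵇ ν i')
              ∨ not (≻ᵇ (at ν (suc i')) (at ν u +ᵖ (⌊ (u ∸ i') /2⌋ ∸ 1))))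
      (range i u)

Br : {m : ℕ} → List (Part (suc m)) → ℕ → ℕ
Br ν i =
  if bridgeCond ν i j then j
  else lastSat (λ u → inIᵇ ν u ∧ bridgeCond ν i u) (range (suc i) j) i
  where j = nextJ ν i

module Submission where

-- The argument rests on one composition law, bridge-trans: if i bridges to
-- an upper half r and r bridges to some w beyond the lower half r + 1, then
-- i bridges to w.  Its numerical core, non-domination-trans, says that
-- A ⊁ U + d₁ and B ⊁ W + d₂, for the two halves U, B of one secondary part,
-- give A ⊁ W + d₃ whenever d₁ + d₂ < d₃; the gaps ⌊d/2⌋ - 1 of the bridge
-- condition are strictly superadditive, so this applies.
--
-- Both claims then follow by case
-- analysis on BrSpec and bridge-trans.

open import Defs
open import Data.Nat using (ℕ; suc; _≤_)
open import Data.List using (List)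
open import Data.Product using (_×_)
open import Relation.Binary.PropositionalEquality using (_≡_)

open import Data.Nat using (zero; _+_; _∸_; _<_; z≤n; s≤s; ⌊_/2⌋; _≡ᵇ_)
open import Data.Nat.Properties
open import Data.Bool using (Bool; true; false; if_then_else_; not; _∧_; _∨_; T)
open import Data.Bool.Properties using (T-∧; T-∨)
open import Data.Unit using (tt)
open import Data.Fin using (Fin; toℕ)
open import Data.List using ([]; _∷_; length)
open import Data.List.Membership.Propositional using (_∈_; lose)
open import Data.List.Membership.Propositional.Properties using (∈-map⁺; ∈-map⁻; ∈-upTo⁺; ∈-upTo⁻)
import Data.List.Relation.Unary.All as All
open import Data.List.Relation.Unary.Any using (Any; here; there)
open import Data.List.Relation.Unary.AllPairs using (AllPairs; []; _∷_)
import Data.List.Relation.Unary.AllPairs.Properties as AllPairs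
open import Data.Maybe using (just)
open import Data.Product using (∃; _,_; proj₁; proj₂)
open import Data.Sum using (_⊎_; inj₁; inj₂)
open import Data.Empty using (⊥-elim)
open import Function using (_∘_; Equivalence)
open import Relation.Nullary using (¬_; yes; no)
open import Relation.Binary.PropositionalEquality using (refl; sym; trans; cong; subst; module ≡-Reasoning)
open import Data.Nat.Tactic.RingSolver using (solve-∀)

open Equivalence using (to; from)

χ≤1 : ∀ b → χ b ≤ 1
χ≤1 true = ≤-refl
χ≤1 false = z≤n

χ-sum-bound : ∀ b₁ b₂ b₃ → (T b₁ → T b₂ → T b₃) → χ b₁ + χ b₂ ≤ suc (χ b₃)
χ-sum-bound true true true _ = ≤-refl
χ-sum-bound true true false forced = ⊥-elim (forced tt tt)
χ-sum-bound true false _ _ = s≤s z≤n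
χ-sum-bound false true _ _ = s≤s z≤n
χ-sum-bound false false _ _ = z≤n

⌊/2⌋-superadditive : ∀ x y → ⌊ x /2⌋ + ⌊ y /2⌋ ≤ ⌊ (x + y) /2⌋
⌊/2⌋-superadditive zero y = ≤-refl
⌊/2⌋-superadditive (suc zero) y = ⌊n/2⌋-mono (n≤1+n y)
⌊/2⌋-superadditive (suc (suc x)) y = s≤s (⌊/2⌋-superadditive x y)

-- The shift ⌊d/2⌋ - 1 that the bridge condition attaches to a distance d.
gap : ℕ → ℕ
gap d = ⌊ d /2⌋ ∸ 1

gap-superadditive : ∀ x y → 2 ≤ x → 2 ≤ y → gap x + gap y < gap (x + y)
gap-superadditive (suc zero) _ (s≤s ()) _
gap-superadditive (suc (suc x)) (suc zero) _ (s≤s ())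
gap-superadditive (suc (suc x)) (suc (suc y)) _ _
  rewrite +-suc x (suc y) | +-suc x y = s≤s (⌊/2⌋-superadditive x y)

distance-split : ∀ {i r w} → i ≤ r → r ≤ w → w ∸ i ≡ (r ∸ i) + (w ∸ r)
distance-split {i} {r} {w} i≤r r≤w = begin
  w ∸ i                ≡⟨ cong (_∸ i) (sym (m∸n+n≡m r≤w)) ⟩
  (w ∸ r + r) ∸ i      ≡⟨ +-∸-assoc (w ∸ r) i≤r ⟩
  (w ∸ r) + (r ∸ i)    ≡⟨ +-comm (w ∸ r) (r ∸ i) ⟩
  (r ∸ i) + (w ∸ r)    ∎
  where open ≡-Reasoning

distance≥2 : ∀ {i r} → suc i < r → 2 ≤ r ∸ i
distance≥2 {i} {r} lt = subst (_≤ r ∸ i) (m+n∸n≡m 2 i) (∸-monoˡ-≤ i lt)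

-- The linear arithmetic behind composing two non-dominations: the slack
-- lost at U, B (bounded by hχ) is paid for by the extra gap d₃ > d₁ + d₂.
compose-bound : ∀ {a u b w d₁ d₂ d₃ x₁ x₂ x₃} →
  a < u + d₁ + x₁ → b < w + d₂ + x₂ → u + x₁ + x₂ ≤ 2 + b + x₃ → d₁ + d₂ < d₃ →
  a < w + d₃ + x₃
compose-bound {a} {u} {b} {w} {d₁} {d₂} {d₃} {x₁} {x₂} {x₃} h₁ h₂ hχ hd =
  +-cancelʳ-≤ (suc b) (suc a) (w + d₃ + x₃) (begin
    suc a + suc b                        ≤⟨ +-mono-≤ h₁ h₂ ⟩
    (u + d₁ + x₁) + (w + d₂ + x₂)        ≡⟨ regroup₁ u d₁ x₁ w d₂ x₂ ⟩
    (u + x₁ + x₂) + (d₁ + d₂ + w)        ≤⟨ +-monoˡ-≤ (d₁ + d₂ + w) hχ ⟩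
    (2 + b + x₃) + (d₁ + d₂ + w)         ≡⟨ regroup₂ b x₃ d₁ d₂ w ⟩
    (suc (d₁ + d₂) + w + x₃) + suc b     ≤⟨ +-monoˡ-≤ (suc b) (+-monoˡ-≤ x₃ (+-monoˡ-≤ w hd)) ⟩
    (d₃ + w + x₃) + suc b                ≡⟨ cong (_+ suc b) (cong (_+ x₃) (+-comm d₃ w)) ⟩
    (w + d₃ + x₃) + suc b                ∎)
  where
  open ≤-Reasoning
  regroup₁ : ∀ u d₁ x₁ w d₂ x₂ →
    (u + d₁ + x₁) + (w + d₂ + x₂) ≡ (u + x₁ + x₂) + (d₁ + d₂ + w)
  regroup₁ = solve-∀
  regroup₂ : ∀ b x₃ d₁ d₂ w →
    (2 + b + x₃) + (d₁ + d₂ + w) ≡ (suc (d₁ + d₂) + w + x₃) + suc b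
  regroup₂ = solve-∀

not∨not-sound : ∀ {b c} → T (not b ∨ not c) → T b → ¬ T c
not∨not-sound {true} {true} () _
not∨not-sound {true} {false} _ _ ()

not∨not-complete : ∀ {b c} → (T b → ¬ T c) → T (not b ∨ not c)
not∨not-complete {false} _ = tt
not∨not-complete {true} {false} _ = tt
not∨not-complete {true} {true} h = ⊥-elim (h tt tt)

allᵇ-sound : ∀ {p xs y} → T (allᵇ p xs) → y ∈ xs → T (p y)
allᵇ-sound t (here refl) = proj₁ (to T-∧ t)
allᵇ-sound t (there y∈xs) = allᵇ-sound (proj₂ (to T-∧ t)) y∈xs

allᵇ-complete : ∀ {p} xs → (∀ {y} → y ∈ xs → T (p y)) → T (allᵇ p xs)
allᵇ-complete [] _ = tt
allᵇ-complete (x ∷ xs) h = from T-∧ (h (here refl) , allᵇ-complete xs (h ∘ there))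

firstSat-spec : ∀ {p xs} d → AllPairs _<_ xs → Any (T ∘ p) xs →
  let r = firstSat p xs d in r ∈ xs × T (p r) × (∀ {y} → y ∈ xs → y < r → ¬ T (p y))
firstSat-spec {p} {x ∷ xs} d (x<xs ∷ increasing) some with p x in px
... | true = here refl , subst T (sym px) tt , least
  where
  least : ∀ {y} → y ∈ x ∷ xs → y < x → ¬ T (p y)
  least (here refl) y<x = ⊥-elim (<-irrefl refl y<x)
  least (there y∈xs) y<x = ⊥-elim (<-asym y<x (All.lookup x<xs y∈xs))
... | false with firstSat-spec d increasing (tail-has some)
  where
  tail-has : Any (T ∘ p) (x ∷ xs) → Any (T ∘ p) xs
  tail-has (here px-holds) = ⊥-elim (subst T px px-holds)
  tail-has (there found) = found
...   | r∈xs , pr , least = there r∈xs , pr , least′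
  where
  least′ : ∀ {y} → y ∈ x ∷ xs → y < firstSat p xs d → ¬ T (p y)
  least′ (here refl) _ py = subst T px py
  least′ (there y∈xs) y<r = least y∈xs y<r

lastSat-spec : ∀ {p xs} d → AllPairs _<_ xs →
  let r = lastSat p xs d in
  (r ≡ d ⊎ (r ∈ xs × T (p r))) × (∀ {y} → y ∈ xs → T (p y) → y ≤ r)
lastSat-spec {xs = []} d [] = inj₁ refl , λ ()
lastSat-spec {p} {x ∷ xs} d (x<xs ∷ increasing) with p x in px
... | true with lastSat-spec {p} x increasing
...   | found , largest = found′ found , largest′
  where
  r : ℕ
  r = lastSat p xs x
  above-x : r ≡ x ⊎ (r ∈ xs × T (p r)) → x ≤ r
  above-x (inj₁ r≡x) = ≤-reflexive (sym r≡x)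
  above-x (inj₂ (r∈xs , _)) = <⇒≤ (All.lookup x<xs r∈xs)
  found′ : r ≡ x ⊎ (r ∈ xs × T (p r)) → r ≡ d ⊎ (r ∈ x ∷ xs × T (p r))
  found′ (inj₁ r≡x) = inj₂ (here r≡x , subst (T ∘ p) (sym r≡x) (subst T (sym px) tt))
  found′ (inj₂ (r∈xs , pr)) = inj₂ (there r∈xs , pr)
  largest′ : ∀ {y} → y ∈ x ∷ xs → T (p y) → y ≤ r
  largest′ (here refl) _ = above-x found
  largest′ (there y∈xs) py = largest y∈xs py
lastSat-spec {p} {x ∷ xs} d (x<xs ∷ increasing) | false with lastSat-spec {p} d increasing
...   | found , largest = found′ found , largest′
  where
  r : ℕ
  r = lastSat p xs d
  found′ : r ≡ d ⊎ (r ∈ xs × T (p r)) → r ≡ d ⊎ (r ∈ x ∷ xs × T (p r))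
  found′ (inj₁ r≡d) = inj₁ r≡d
  found′ (inj₂ (r∈xs , pr)) = inj₂ (there r∈xs , pr)
  largest′ : ∀ {y} → y ∈ x ∷ xs → T (p y) → y ≤ r
  largest′ (here refl) py = ⊥-elim (subst T px py)
  largest′ (there y∈xs) py = largest y∈xs py

∈-range⁺ : ∀ {a b y} → a ≤ y → y < b → y ∈ range a b
∈-range⁺ {a} {b} a≤y y<b =
  subst (_∈ range a b) (m+[n∸m]≡n a≤y) (∈-map⁺ (a +_) (∈-upTo⁺ (∸-monoˡ-< y<b a≤y)))

∈-range⁻ : ∀ {a b y} → y ∈ range a b → a ≤ y × y < b
∈-range⁻ {a} {b} y∈ with ∈-map⁻ (a +_) y∈
... | x , x∈ , refl = m≤m+n a x , a+x<b
  where
  x<b∸a : x < b ∸ a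
  x<b∸a = ∈-upTo⁻ x∈
  a≤b : a ≤ b
  a≤b = <⇒≤ (m∸n≢0⇒n<m (λ b∸a≡0 → n≮0 (subst (x <_) b∸a≡0 x<b∸a)))
  a+x<b : a + x < b
  a+x<b = subst (_≤ b) (cong suc (+-comm x a)) (m≤o∸n⇒m+n≤o (suc x) a≤b x<b∸a)

range-increasing : ∀ a b → AllPairs _<_ (range a b)
range-increasing a b =
  AllPairs.map⁺ (AllPairs.applyUpTo⁺₁ (λ k → k) (b ∸ a) (λ i<j _ → +-monoʳ-< a i<j))

≤ᶜ⇒key₁≤ : ∀ {n} (p q : Color n) → T (p ≤ᶜ q) → key₁ p ≤ key₁ q
≤ᶜ⇒key₁≤ p q t with to T-∨ t
... | inj₁ lt = <⇒≤ (<ᵇ⇒< (key₁ p) (key₁ q) lt)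
... | inj₂ eq∧ = ≤-reflexive (≡ᵇ⇒≡ (key₁ p) (key₁ q) (proj₁ (to T-∧ eq∧)))

key₁<⇒≤ᶜ : ∀ {n} (p q : Color n) → key₁ p < key₁ q → T (p ≤ᶜ q)
key₁<⇒≤ᶜ p q lt = from T-∨ (inj₁ (<⇒<ᵇ lt))

≻ᵇ-sound : ∀ {n} (x y : Part n) → T (≻ᵇ x y) → x ≻ y
≻ᵇ-sound (k , p) (l , q) = ≤ᵇ⇒≤ (l + χ (p ≤ᶜ q)) k

≻ᵇ-complete : ∀ {n} (x y : Part n) → x ≻ y → T (≻ᵇ x y)
≻ᵇ-complete (k , p) (l , q) = ≤⇒≤ᵇ

Halves : ∀ {n} → Part n → Part n → Set
Halves U B = size U ≡ size B ⊎ (size U ≡ suc (size B) × key₁ (color U) < key₁ (color B))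

-- The halves α, β of a secondary part stand in this relation (induction on
-- the size in steps of two; a wrong parity case contradicts a < b).
halves-αβ : ∀ {n} s (a b : Fin n) → toℕ a < toℕ b → Halves (αsec s a b) (βsec s a b)
halves-αβ zero a b a<b = inj₁ refl
halves-αβ (suc zero) a b a<b = inj₂ (refl , a<b)
halves-αβ (suc (suc s)) a b a<b with isEven s | halves-αβ s a b a<b
... | _ | inj₁ same = inj₁ (cong suc same)
... | false | inj₂ (larger , lt) = inj₂ (cong suc larger , lt)
... | true | inj₂ (_ , b<a) = ⊥-elim (<-asym a<b b<a)

-- For halves U, B the drop in size pays for the χ-terms.  In the odd case
-- χ(A ≤ U) and χ(B ≤ W) together force χ(A ≤ W), as key₁ U < key₁ B.
χ-through-halves : ∀ {n} {u b} {cA cU cB cW : Color n} → Halves (u , cU) (b , cB) →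
  u + χ (cA ≤ᶜ cU) + χ (cB ≤ᶜ cW) ≤ 2 + b + χ (cA ≤ᶜ cW)
χ-through-halves {u = u} {cA = cA} {cU} {cB} {cW} (inj₁ refl) = begin
  u + χ (cA ≤ᶜ cU) + χ (cB ≤ᶜ cW)   ≡⟨ +-assoc u _ _ ⟩
  u + (χ (cA ≤ᶜ cU) + χ (cB ≤ᶜ cW)) ≤⟨ +-monoʳ-≤ u (+-mono-≤ (χ≤1 (cA ≤ᶜ cU)) (χ≤1 (cB ≤ᶜ cW))) ⟩
  u + 2                             ≡⟨ +-comm u 2 ⟩
  2 + u                             ≤⟨ m≤m+n (2 + u) _ ⟩
  2 + u + χ (cA ≤ᶜ cW)              ∎
  where open ≤-Reasoning
χ-through-halves {b = b} {cA} {cU} {cB} {cW} (inj₂ (refl , cU<cB)) = s≤s (begin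
  b + χ (cA ≤ᶜ cU) + χ (cB ≤ᶜ cW)   ≡⟨ +-assoc b _ _ ⟩
  b + (χ (cA ≤ᶜ cU) + χ (cB ≤ᶜ cW)) ≤⟨ +-monoʳ-≤ b (χ-sum-bound (cA ≤ᶜ cU) (cB ≤ᶜ cW) (cA ≤ᶜ cW) forced) ⟩
  b + suc (χ (cA ≤ᶜ cW))            ≡⟨ +-suc b _ ⟩
  suc (b + χ (cA ≤ᶜ cW))            ∎)
  where
  open ≤-Reasoning
  forced : T (cA ≤ᶜ cU) → T (cB ≤ᶜ cW) → T (cA ≤ᶜ cW)
  forced t₁ t₂ = key₁<⇒≤ᶜ cA cW
    (≤-<-trans (≤ᶜ⇒key₁≤ cA cU t₁) (<-≤-trans cU<cB (≤ᶜ⇒key₁≤ cB cW t₂)))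

non-domination-trans : ∀ {n} (A U B W : Part n) {d₁ d₂ d₃} → Halves U B → d₁ + d₂ < d₃ →
  ¬ A ≻ (U +ᵖ d₁) → ¬ B ≻ (W +ᵖ d₂) → ¬ A ≻ (W +ᵖ d₃)
non-domination-trans (a , cA) (u , cU) (b , cB) (w , cW) halves d₁+d₂<d₃ A⊁U B⊁W A≻W =
  <⇒≱ (compose-bound {a} {u} {b} {w} (≰⇒> A⊁U) (≰⇒> B⊁W)
         (χ-through-halves {cA = cA} {cU} {cB} {cW} halves) d₁+d₂<d₃) A≻W

upper-then-lower : ∀ {n} (ν : List (Part n)) k {x} → nth (expand ν) k ≡ just (x , upperK) →
  ∃ λ y → nth (expand ν) (suc k) ≡ just (y , lowerK) × Halves x y
upper-then-lower ((s , prim a) ∷ ν) (suc k) e = upper-then-lower ν k e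
upper-then-lower ((s , sec a b a<b) ∷ ν) zero refl = βsec s a b , refl , halves-αβ s a b a<b
upper-then-lower ((s , sec a b a<b) ∷ ν) (suc (suc k)) e = upper-then-lower ν k e

entry-bound : ∀ {n} (ν : List (Part n)) k {z} → entry ν k ≡ just z → k ≤ len ν
entry-bound ν (suc k) e = nth-bound (expand ν) k e
  where
  nth-bound : ∀ {A : Set} (xs : List A) k {x} → nth xs k ≡ just x → k < length xs
  nth-bound (_ ∷ xs) zero _ = s≤s z≤n
  nth-bound (_ ∷ xs) (suc k) e = s≤s (nth-bound xs k e)

kindIs-entry : ∀ {n} κ (ν : List (Part n)) k {x κ′} → entry ν k ≡ just (x , κ′) →
  kindIs κ ν k ≡ isKind κ κ′
kindIs-entry κ ν k e with entry ν k
kindIs-entry κ ν k refl | just _ = refl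

at-entry : ∀ {m} (ν : List (Part (suc m))) k {x κ} → entry ν k ≡ just (x , κ) → at ν k ≡ x
at-entry ν k e with entry ν k
at-entry ν k refl | just _ = refl

module Bridge {m : ℕ} (ν : List (Part (suc m))) where

  L : ℕ
  L = len ν

  stop? : ℕ → Bool
  stop? k = inJᵇ ν k ∨ (k ≡ᵇ suc L)

  Stop : ℕ → Set
  Stop k = T (stop? k)

  J : ℕ → ℕ
  J = nextJ ν

  half-not-Stop : ∀ {k x κ} → entry ν k ≡ just (x , κ) → isKind primK κ ≡ false → ¬ Stop k
  half-not-Stop {k} e not-primary stop with to T-∨ stop
  ... | inj₁ primary = subst T (trans (kindIs-entry primK ν k e) not-primary) primary
  ... | inj₂ sentinel = 1+n≰n (subst (_≤ L) (≡ᵇ⇒≡ k (suc L) sentinel) (entry-bound ν k e))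

  I-entry : ∀ {k} → k ∈I ν → entry ν k ≡ just (at ν k , upperK)
  I-entry {k} k∈I with entry ν k
  I-entry k∈I | just (x , upperK) = refl

  I-next : ∀ {k} → k ∈I ν →
    entry ν (suc k) ≡ just (at ν (suc k) , lowerK) × Halves (at ν k) (at ν (suc k))
  I-next {suc k} k∈I with upper-then-lower ν k (I-entry {suc k} k∈I)
  ... | y , e , halves = e′ , subst (Halves (at ν (suc k))) (sym (at-entry ν (suc (suc k)) e)) halves
    where
    e′ : entry ν (suc (suc k)) ≡ just (at ν (suc (suc k)) , lowerK)
    e′ = trans e (cong (λ z → just (z , lowerK)) (sym (at-entry ν (suc (suc k)) e)))

  I-bound : ∀ {k} → k ∈I ν → k ≤ L
  I-bound {k} k∈I = entry-bound ν k (I-entry {k} k∈I)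

  I-not-Stop : ∀ {k} → k ∈I ν → ¬ Stop k
  I-not-Stop {k} k∈I = half-not-Stop {k} (I-entry {k} k∈I) refl

  lower-not-Stop : ∀ {k} → k ∈I ν → ¬ Stop (suc k)
  lower-not-Stop {k} k∈I = half-not-Stop {suc k} (proj₁ (I-next {k} k∈I)) refl

  lower-not-I : ∀ {k} → k ∈I ν → ¬ suc k ∈I ν
  lower-not-I {k} k∈I k+1∈I = subst T (kindIs-entry upperK ν (suc k) (proj₁ (I-next {k} k∈I))) k+1∈I

  nextJ-spec : ∀ {i} → i ≤ L → i < J i × Stop (J i) × (∀ {y} → i < y → y < J i → ¬ Stop y)
  nextJ-spec {i} i≤L with firstSat-spec {p = stop?} (suc L) (range-increasing (suc i) (suc (suc L)))
                            (lose (∈-range⁺ (s≤s i≤L) ≤-refl) sentinel-stops)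
    where
    sentinel-stops : Stop (suc L)
    sentinel-stops = from T-∨ (inj₂ (≡⇒≡ᵇ (suc L) (suc L) refl))
  ... | J∈ , stop , least = proj₁ J-bounds , stop ,
        λ {y} i<y y<J → least (∈-range⁺ i<y (<-trans y<J (proj₂ J-bounds))) y<J
    where
    J-bounds : i < J i × J i < suc (suc L)
    J-bounds = ∈-range⁻ {suc i} {suc (suc L)} J∈

  nextJ-same : ∀ {i i′} → i ≤ L → i′ ≤ L → i ≤ i′ → i′ < J i → J i′ ≡ J i
  nextJ-same {i} {i′} i≤L i′≤L i≤i′ i′<Ji = ≤-antisym
    (≮⇒≥ λ Ji<Ji′ → proj₂ (proj₂ (nextJ-spec i′≤L)) i′<Ji Ji<Ji′ (proj₁ (proj₂ (nextJ-spec i≤L))))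
    (≮⇒≥ λ Ji′<Ji → proj₂ (proj₂ (nextJ-spec i≤L))
        (≤-<-trans i≤i′ (proj₁ (nextJ-spec i′≤L))) Ji′<Ji (proj₁ (proj₂ (nextJ-spec i′≤L))))

  Blocked : ℕ → ℕ → Set
  Blocked i′ u = ¬ (at ν (suc i′) ≻ (at ν u +ᵖ gap (u ∸ i′)))

  Bridgeable : ℕ → ℕ → Set
  Bridgeable i u = ∀ {i′} → i ≤ i′ → i′ < u → i′ ∈I ν → Blocked i′ u

  bridgeCond-sound : ∀ {i u} → T (bridgeCond ν i u) → Bridgeable i u
  bridgeCond-sound {i} {u} t {i′} i≤i′ i′<u i′∈I dominates =
    not∨not-sound (allᵇ-sound t (∈-range⁺ i≤i′ i′<u)) i′∈I
      (≻ᵇ-complete (at ν (suc i′)) (at ν u +ᵖ gap (u ∸ i′)) dominates)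

  bridgeCond-complete : ∀ {i u} → Bridgeable i u → T (bridgeCond ν i u)
  bridgeCond-complete {i} {u} bridge = allᵇ-complete (range i u) λ {i′} i′∈ →
    not∨not-complete λ i′∈I →
      bridge (proj₁ (∈-range⁻ {i} i′∈)) (proj₂ (∈-range⁻ {i} i′∈)) i′∈I
      ∘ ≻ᵇ-sound (at ν (suc i′)) (at ν u +ᵖ gap (u ∸ i′))

  bridgeable-shorten : ∀ {i i′ u} → i ≤ i′ → Bridgeable i u → Bridgeable i′ u
  bridgeable-shorten i≤i′ bridge i′≤k k<u k∈I = bridge (≤-trans i≤i′ i′≤k) k<u k∈I

  blocked-trans : ∀ {i′ r w} → r ∈I ν → suc i′ < r → suc r < w →
    Blocked i′ r → Blocked r w → Blocked i′ w
  blocked-trans {i′} {r} {w} r∈I i′+1<r r+1<w blocked₁ blocked₂ =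
    subst (λ d → ¬ (at ν (suc i′) ≻ (at ν w +ᵖ gap d))) (sym (distance-split i′≤r r≤w))
      (non-domination-trans (at ν (suc i′)) (at ν r) (at ν (suc r)) (at ν w)
        (proj₂ (I-next {r} r∈I))
        (gap-superadditive (r ∸ i′) (w ∸ r) (distance≥2 i′+1<r) (distance≥2 r+1<w))
        blocked₁ blocked₂)
    where
    i′≤r : i′ ≤ r
    i′≤r = <⇒≤ (<-trans (n<1+n i′) i′+1<r)
    r≤w : r ≤ w
    r≤w = <⇒≤ (<-trans (n<1+n r) r+1<w)

  bridge-trans : ∀ {i r w} → r ∈I ν → i ≤ r → suc r < w →
    Bridgeable i r → Bridgeable r w → Bridgeable i w
  bridge-trans {i} {r} {w} r∈I i≤r r+1<w bridge₁ bridge₂ {i′} i≤i′ i′<w i′∈I with r ≤? i′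
  ... | yes r≤i′ = bridge₂ r≤i′ i′<w i′∈I
  ... | no r≰i′ = blocked-trans r∈I i′+1<r r+1<w
                    (bridge₁ i≤i′ i′<r i′∈I) (bridge₂ ≤-refl (<-trans (n<1+n r) r+1<w) r∈I)
    where
    i′<r : i′ < r
    i′<r = ≰⇒> r≰i′
    i′+1<r : suc i′ < r
    i′+1<r = ≤∧≢⇒< i′<r (λ e → lower-not-I {i′} i′∈I (subst (_∈I ν) (sym e) r∈I))

  Candidate : ℕ → ℕ → Set
  Candidate i u = i < u × u < J i × u ∈I ν × Bridgeable i u

  data BrSpec (i : ℕ) : ℕ → Set where
    reach : Bridgeable i (J i) → BrSpec i (J i)
    stay  : ¬ Bridgeable i (J i) → (∀ {u} → Candidate i u → u ≤ i) → BrSpec i i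
    land  : ∀ {r} → ¬ Bridgeable i (J i) → Candidate i r →
            (∀ {u} → Candidate i u → u ≤ r) → BrSpec i r

  Br-spec : ∀ i → BrSpec i (Br ν i)
  Br-spec i = by-cases (bridgeCond ν i (J i)) refl
    where
    candidate? : ℕ → Bool
    candidate? u = inIᵇ ν u ∧ bridgeCond ν i u
    landing : ℕ
    landing = lastSat candidate? (range (suc i) (J i)) i
    candidate⁺ : ∀ {u} → u ∈ range (suc i) (J i) → T (candidate? u) → Candidate i u
    candidate⁺ {u} u∈ t = proj₁ (∈-range⁻ {suc i} {J i} u∈) , proj₂ (∈-range⁻ {suc i} {J i} u∈) ,
                          proj₁ both , bridgeCond-sound (proj₂ both)
      where
      both : u ∈I ν × T (bridgeCond ν i u)
      both = to (T-∧ {inIᵇ ν u}) t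
    candidate⁻ : ∀ {u} → Candidate i u → u ∈ range (suc i) (J i) × T (candidate? u)
    candidate⁻ (i<u , u<J , u∈I , bridge) =
      ∈-range⁺ i<u u<J , from T-∧ (u∈I , bridgeCond-complete bridge)
    by-cases : ∀ b → bridgeCond ν i (J i) ≡ b → BrSpec i (if b then J i else landing)
    by-cases true bc = reach (bridgeCond-sound (subst T (sym bc) tt))
    by-cases false bc = from-landing (proj₁ spec)
      where
      spec : (landing ≡ i ⊎ (landing ∈ range (suc i) (J i) × T (candidate? landing)))
             × (∀ {u} → u ∈ range (suc i) (J i) → T (candidate? u) → u ≤ landing)
      spec = lastSat-spec {candidate?} i (range-increasing (suc i) (J i))
      no-bridge : ¬ Bridgeable i (J i)
      no-bridge bridge = subst T bc (bridgeCond-complete bridge)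
      maximal : ∀ {u} → Candidate i u → u ≤ landing
      maximal c = proj₂ spec (proj₁ (candidate⁻ c)) (proj₂ (candidate⁻ c))
      from-landing : landing ≡ i ⊎ (landing ∈ range (suc i) (J i) × T (candidate? landing)) →
        BrSpec i landing
      from-landing (inj₁ landing≡i) =
        subst (BrSpec i) (sym landing≡i) (stay no-bridge (subst (_ ≤_) landing≡i ∘ maximal))
      from-landing (inj₂ (l∈ , t)) = land no-bridge (candidate⁺ l∈ t) maximal

  Br-lower : ∀ {i r} → i ≤ L → BrSpec i r → i ≤ r
  Br-lower i≤L (reach _) = <⇒≤ (proj₁ (nextJ-spec i≤L))
  Br-lower _ (stay _ _) = ≤-refl
  Br-lower _ (land _ (i<r , _) _) = <⇒≤ i<r

  Br-upper : ∀ {i r} → i ≤ L → BrSpec i r → r ≤ J i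
  Br-upper _ (reach _) = ≤-refl
  Br-upper i≤L (stay _ _) = <⇒≤ (proj₁ (nextJ-spec i≤L))
  Br-upper _ (land _ (_ , r<J , _) _) = <⇒≤ r<J

  same-segment : ∀ {i i′ r r′} → i ≤ i′ → i′ ≤ L → J i′ ≡ J i →
    BrSpec i r → BrSpec i′ r′ → r ≤ r′
  same-segment {i} {i′} i≤i′ i′≤L same (reach bridge) = reached
    where
    bridge′ : Bridgeable i′ (J i′)
    bridge′ = subst (Bridgeable i′) (sym same) (bridgeable-shorten i≤i′ bridge)
    reached : ∀ {r′} → BrSpec i′ r′ → J i ≤ r′
    reached (reach _) = ≤-reflexive (sym same)
    reached (stay no-bridge _) = ⊥-elim (no-bridge bridge′)
    reached (land no-bridge _ _) = ⊥-elim (no-bridge bridge′)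
  same-segment i≤i′ i′≤L _ (stay _ _) s′ = ≤-trans i≤i′ (Br-lower i′≤L s′)
  same-segment {i} {i′} {r} i≤i′ i′≤L same (land _ (_ , r<J , r∈I , bridge) _) s′ with r ≤? i′
  ... | yes r≤i′ = ≤-trans r≤i′ (Br-lower i′≤L s′)
  ... | no r≰i′ = beaten s′
    where
    candidate′ : Candidate i′ r
    candidate′ = ≰⇒> r≰i′ , subst (r <_) (sym same) r<J , r∈I , bridgeable-shorten i≤i′ bridge
    beaten : ∀ {r′} → BrSpec i′ r′ → r ≤ r′
    beaten (reach _) = <⇒≤ (proj₁ (proj₂ candidate′))
    beaten (stay _ maximal) = maximal candidate′
    beaten (land _ _ maximal) = maximal candidate′

  -- Monotonicity: if i′ is past J i then Br ν i ≤ J i ≤ i′ ≤ Br ν i′;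
  -- otherwise i and i′ share their next stop.
  Br-monotone : ∀ i i′ → i ∈I ν → i′ ∈I ν → i ≤ i′ → Br ν i ≤ Br ν i′
  Br-monotone i i′ i∈I i′∈I i≤i′ with J i ≤? i′
  ... | yes Ji≤i′ = ≤-trans (Br-upper (I-bound {i} i∈I) (Br-spec i))
                      (≤-trans Ji≤i′ (Br-lower (I-bound {i′} i′∈I) (Br-spec i′)))
  ... | no Ji≰i′ = same-segment i≤i′ (I-bound {i′} i′∈I)
                     (nextJ-same (I-bound {i} i∈I) (I-bound {i′} i′∈I) i≤i′ (≰⇒> Ji≰i′))
                     (Br-spec i) (Br-spec i′)

  -- A landing point r > i that is an upper half is fixed by Br: bridging
  -- further from r would, by bridge-trans, give i a better landing point.
  landing-fixed : ∀ {i r} → i ≤ L → BrSpec i r → r ∈I ν → i < r → Br ν r ≡ r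
  landing-fixed {i} i≤L (reach _) J∈I _ = ⊥-elim (I-not-Stop {J i} J∈I (proj₁ (proj₂ (nextJ-spec i≤L))))
  landing-fixed _ (stay _ _) _ i<i = ⊥-elim (<-irrefl refl i<i)
  landing-fixed {i} {r} i≤L (land no-bridge (i<r , r<J , r∈I , bridge) maximal) _ _ = stays (Br-spec r)
    where
    same : J r ≡ J i
    same = nextJ-same i≤L (I-bound {r} r∈I) (<⇒≤ i<r) r<J
    stays : ∀ {r′} → BrSpec r r′ → r′ ≡ r
    stays (reach bridge′) =
      ⊥-elim (no-bridge (bridge-trans r∈I (<⇒≤ i<r) r+1<J bridge (subst (Bridgeable r) same bridge′)))
      where
      r+1<J : suc r < J i
      r+1<J = ≤∧≢⇒< r<J (λ e → lower-not-Stop {r} r∈I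
                (subst Stop (sym e) (proj₁ (proj₂ (nextJ-spec i≤L)))))
    stays (stay _ _) = refl
    stays {u} (land _ (r<u , u<J , u∈I , bridge′) _) =
      ⊥-elim (<⇒≱ r<u (maximal (<-trans i<r r<u , subst (u <_) same u<J , u∈I ,
                                bridge-trans r∈I (<⇒≤ i<r) r+1<u bridge bridge′)))
      where
      r+1<u : suc r < u
      r+1<u = ≤∧≢⇒< r<u (λ e → lower-not-I {r} r∈I (subst (_∈I ν) (sym e) u∈I))

  Br-idempotent : ∀ i → i ∈I ν → Br ν i ∈I ν → Br ν (Br ν i) ≡ Br ν i
  Br-idempotent i i∈I Br∈I = by-order (m≤n⇒m<n∨m≡n (Br-lower i≤L (Br-spec i)))
    where
    i≤L : i ≤ L
    i≤L = I-bound {i} i∈I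
    by-order : i < Br ν i ⊎ i ≡ Br ν i → Br ν (Br ν i) ≡ Br ν i
    by-order (inj₁ i<Br) = landing-fixed i≤L (Br-spec i) Br∈I i<Br
    by-order (inj₂ i≡Br) = cong (Br ν) (sym i≡Br)

lemma5p1 : (m : ℕ) (ν : List (Part (suc m))) → InE ν →
    ((i i' : ℕ) → i ∈I ν → i' ∈I ν → i ≤ i' → Br ν i ≤ Br ν i')
    × ((i : ℕ) → i ∈I ν → Br ν i ∈I ν → Br ν (Br ν i) ≡ Br ν i)
lemma5p1 m ν _ = Br-monotone , Br-idempotent
  where open Bridge ν
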